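{- Let $q=ef+1$ be an odd prime power, $\gamma$ a primitive element of $GF(q)$, and $D=C_i^e\cup\{0\}$ for some $i\in\{0,1,\dots,e-1\}$. Then $D$ is an almost difference set in $(GF(q),+)$ with parameters $(q,f+1,\lambda,t)$ if and only if $$\begin{cases}\{(0,0)_e+2\}\cup\{(0,j)_e : 1\le j\le e-1\}=\{\lambda,\lambda+1\} & \text{if } f \text{ is even},\\ \{(\tfrac{e}{2},0)_e+1,(\tfrac{e}{2},\tfrac{e}{2})_e+1\}\cup\{(\tfrac{e}{2},j)_e : 0\le j\le e-1,\ j\ne 0,\tfrac{e}{2}\}=\{\lambda,\lambda+1\} & \text{if } f \text{ is odd}.\end{cases}$$
   Context: Cyclotomic classes: $C_0^e=\{\gamma^{es}:0\le s\le f-1\}$, $C_i^e=\gamma^iC_0^e$, indices mod $e$. Cyclotomic numbers: $(i,j)_e=|(C_i^e+1)\cap C_j^e|$, indices mod $e$. For an additive group $G$ of order $v$, a $k$-subset $D$ is a $(v,k,\lambda,t)$-almost difference set if $d_D(x)=|(D+x)\cap D|$ equals $\lambda$ for exactly $t$ nonzero $x$ and $\lambda+1$ for the other $v-1-t$ nonzero $x$; the paper considers only $0<t<v-1$. -}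

module Defs where

open import Data.Nat as ℕ using (ℕ; zero; suc; _<_; _≤_; _∸_; _%_; _/_)
open import Data.Nat.Primality using (Prime)
open import Data.Fin using (Fin)
import Data.Fin as Fin
open import Data.List using (List; []; _∷_; map; filter; length; upTo; allFin)
open import Data.List.Membership.Propositional using (_∈_)
import Data.List.Membership.DecPropositional as DecMem
open import Data.Product using (Σ; ∃; _×_; _,_)
open import Data.Sum using (_⊎_)
open import Relation.Nullary using (¬_; Dec; yes; no; ¬?)
open import Relation.Nullary.Decidable using (_×-dec_)
open import Relation.Binary.Definitions using (DecidableEquality)
open import Relation.Binary.PropositionalEquality
  using (_≡_; _≢_; refl; sym; trans; cong; setoid)
open import Algebra.Structures using (IsCommutativeRing)
open import Function.Bundles using (Inverse)

record FiniteField (q : ℕ) : Set₁ where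
  infixl 6 _+_
  infixl 7 _*_
  field
    Carrier : Set
    _+_ _*_ : Carrier → Carrier → Carrier
    -_      : Carrier → Carrier
    0# 1#   : Carrier
    isCommutativeRing : IsCommutativeRing _≡_ _+_ _*_ -_ 0# 1#
    0≢1     : 0# ≢ 1#
    inverse : ∀ x → x ≢ 0# → ∃ λ y → x * y ≡ 1#
    enum    : Inverse (setoid (Fin q)) (setoid Carrier)

  elem : Fin q → Carrier
  elem = Inverse.to enum

  index : Carrier → Fin q
  index = Inverse.from enum

  _≟_ : DecidableEquality Carrier
  x ≟ y with index x Fin.≟ index y
  ... | yes p = yes (trans (sym (Inverse.strictlyInverseˡ enum x))
                      (trans (cong elem p) (Inverse.strictlyInverseˡ enum y)))
  ... | no ¬p = no λ { refl → ¬p refl }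

  _^_ : Carrier → ℕ → Carrier
  x ^ zero  = 1#
  x ^ suc n = x * (x ^ n)

  elements : List Carrier
  elements = map elem (allFin q)

  count : {P : Carrier → Set} → ((x : Carrier) → Dec (P x)) → ℕ
  count P? = length (filter P? elements)

  _∈?_ : (x : Carrier) (xs : List Carrier) → Dec (x ∈ xs)
  _∈?_ = DecMem._∈?_ _≟_

IsPrimePower : ℕ → Set
IsPrimePower q = ∃ λ p → ∃ λ k → Prime p × 1 ≤ k × q ≡ p ℕ.^ k

module _ {q : ℕ} (F : FiniteField q) where
  open FiniteField F

  IsPrimitive : Carrier → Set
  IsPrimitive γ = (γ ^ (q ∸ 1) ≡ 1#) × (∀ k → 1 ≤ k → k < q ∸ 1 → γ ^ k ≢ 1#)

  -- cyclotomic class C_i^e = γ^i C_0^e = { γ^(e s + i) : 0 ≤ s ≤ f-1 }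
  -- (for i : ℕ this is automatically periodic in i mod e when q - 1 = e f)
  cyclotomicClass : (γ : Carrier) (e f i : ℕ) → List Carrier
  cyclotomicClass γ e f i = map (λ s → γ ^ (e ℕ.* s ℕ.+ i)) (upTo f)

  -- cyclotomic number (i, j)_e = | (C_i^e + 1) ∩ C_j^e |
  --   = #{ y ∈ C_i^e : y + 1 ∈ C_j^e }
  cyclotomicNumber : (γ : Carrier) (e f i j : ℕ) → ℕ
  cyclotomicNumber γ e f i j =
    count (λ y → (y ∈? cyclotomicClass γ e f i)
                 ×-dec ((y + 1#) ∈? cyclotomicClass γ e f j))

  -- a subset of GF(q), given as a list of elements (membership is what matters)
  -- |D| = number of field elements lying in D
  size : List Carrier → ℕ
  size D = count (λ y → y ∈? D)

  -- difference function d_D(x) = |(D + x) ∩ D| = #{ y ∈ D : y + x ∈ D }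
  diffFun : List Carrier → Carrier → ℕ
  diffFun D x = count (λ y → (y ∈? D) ×-dec ((y + x) ∈? D))

  IsADS : (v k lam t : ℕ) → List Carrier → Set
  IsADS v k lam t D =
    v ≡ q
    × size D ≡ k
    × (∀ x → x ≢ 0# → diffFun D x ≡ lam ⊎ diffFun D x ≡ suc lam)
    × count (λ x → ¬? (x ≟ 0#) ×-dec (diffFun D x ℕ.≟ lam)) ≡ t
    × 0 < t × t < v ∸ 1

SetEqPair : List ℕ → ℕ → Set
SetEqPair S lam = (∀ a → a ∈ S → a ≡ lam ⊎ a ≡ suc lam) × lam ∈ S × suc lam ∈ S

module Submission where

-- For x ≠ 0 choose r with -x ∈ C_{i+r}, and let h be the class of -1, i.e. h = 0 for even f
-- and h = e/2 for odd f. Pairs y, y + x in D = C_i ∪ {0} with y = 0 or y + x = 0 contribute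
-- [r = h] + [r = 0]; the remaining ones correspond, via y ↦ -(y + x)/y, to u ∈ C_h with
-- u + 1 ∈ C_r. Hence d_D(x) = [r = h] + [r = 0] + (h, r)_e, every r < e arises, and D is an
-- almost difference set for λ exactly when these e values form the set {λ, λ + 1}.

open import Defs
open import Data.Nat as ℕ using (ℕ; zero; suc; _≤_; _<_; z≤n; s≤s; NonZero; _%_; _/_; _∸_)
import Data.Nat.Properties as ℕₚ
open import Data.Nat.DivMod
open import Data.Nat.Divisibility using (m∣m*n)
open import Data.Nat.Solver using (module +-*-Solver)
open import Data.List using (List; []; _∷_; _++_; map; filter; length; upTo; allFin)
open import Data.List.Properties using (length-++; length-map; length-tabulate; length-upTo; filter-some; filter-none)
open import Data.List.Membership.Propositional using (_∈_; _∉_; lose)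
open import Data.List.Membership.Propositional.Properties
  using (∈-∃++; ∈-map⁺; ∈-map⁻; ∈-filter⁺; ∈-filter⁻; ∈-allFin; ∈-upTo⁺; ∈-upTo⁻)
open import Data.List.Relation.Binary.Subset.Propositional using (_⊆_)
open import Data.List.Relation.Unary.Any using (here; there)
import Data.List.Relation.Unary.All as All
import Data.List.Relation.Unary.All.Properties as All
open import Data.List.Relation.Unary.AllPairs using ([]; _∷_)
open import Data.List.Relation.Unary.Unique.Propositional using (Unique)
import Data.List.Relation.Unary.Unique.Propositional.Properties as Unique
open import Data.Product using (∃; _×_; _,_; proj₁; proj₂)
open import Data.Sum using (_⊎_; inj₁; inj₂; [_,_]′)
open import Data.Empty using (⊥-elim)
open import Function.Base using (_∘_; id)
open import Function.Bundles using (Inverse; Injection; _⇔_; mk⇔; Equivalence)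
open import Function.Properties.Inverse using (Inverse⇒Injection)
open import Relation.Nullary using (¬_; Dec; yes; no; ¬?)
open import Relation.Nullary.Decidable using (_×-dec_)
open import Relation.Unary using (Decidable)
open import Relation.Binary.PropositionalEquality hiding ([_])
open import Relation.Binary.Definitions using (tri<; tri≈; tri>)
open import Algebra.Bundles using (CommutativeRing)

module _ {a} {A : Set a} where

  ∈-++-∷⁻ : ∀ {x z : A} ys₁ ys₂ → z ∈ ys₁ ++ x ∷ ys₂ → z ≢ x → z ∈ ys₁ ++ ys₂
  ∈-++-∷⁻ []        ys₂ (here refl) z≢x = ⊥-elim (z≢x refl)
  ∈-++-∷⁻ []        ys₂ (there z∈)  _   = z∈
  ∈-++-∷⁻ (y ∷ ys₁) ys₂ (here z≡y)  _   = here z≡y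
  ∈-++-∷⁻ (y ∷ ys₁) ys₂ (there z∈)  z≢x = there (∈-++-∷⁻ ys₁ ys₂ z∈ z≢x)

  Unique-⊆⇒length-≤ : ∀ {xs ys : List A} → Unique xs → xs ⊆ ys → length xs ≤ length ys
  Unique-⊆⇒length-≤ {[]}     _          _  = z≤n
  Unique-⊆⇒length-≤ {x ∷ xs} (x∉xs ∷ u) xs⊆ys with ∈-∃++ (xs⊆ys (here refl))
  ... | ys₁ , ys₂ , refl = begin
    suc (length xs)               ≤⟨ s≤s (Unique-⊆⇒length-≤ u xs⊆ys₁++ys₂) ⟩
    suc (length (ys₁ ++ ys₂))     ≡⟨ cong suc (length-++ ys₁) ⟩
    suc (length ys₁ ℕ.+ length ys₂) ≡⟨ ℕₚ.+-suc (length ys₁) (length ys₂) ⟨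
    length ys₁ ℕ.+ length (x ∷ ys₂) ≡⟨ length-++ ys₁ ⟨
    length (ys₁ ++ x ∷ ys₂)       ∎
    where
    open ℕₚ.≤-Reasoning
    xs⊆ys₁++ys₂ : xs ⊆ ys₁ ++ ys₂
    xs⊆ys₁++ys₂ z∈ = ∈-++-∷⁻ ys₁ ys₂ (xs⊆ys (there z∈)) (λ z≡x → All.lookup x∉xs z∈ (sym z≡x))

  Unique-map⁺ : ∀ {b} {B : Set b} (g : A → B) {xs} → Unique xs →
                (∀ {x y} → x ∈ xs → y ∈ xs → g x ≡ g y → x ≡ y) → Unique (map g xs)
  Unique-map⁺ g []           _   = []
  Unique-map⁺ g (x∉xs ∷ u) inj =
    All.map⁺ (All.tabulate λ y∈ gx≡gy → All.lookup x∉xs y∈ (inj (here refl) (there y∈) gx≡gy))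
    ∷ Unique-map⁺ g u (λ x∈ y∈ → inj (there x∈) (there y∈))

  module _ {p q} {P : A → Set p} {Q : A → Set q} (P? : Decidable P) (Q? : Decidable Q) where

    length-filter-split : ∀ xs → length (filter P? xs) ≡
      length (filter (λ x → P? x ×-dec Q? x) xs) ℕ.+ length (filter (λ x → P? x ×-dec ¬? (Q? x)) xs)
    length-filter-split []       = refl
    length-filter-split (x ∷ xs) with P? x | Q? x
    ... | yes _ | yes _ = cong suc (length-filter-split xs)
    ... | yes _ | no _  = trans (cong suc (length-filter-split xs)) (sym (ℕₚ.+-suc _ _))
    ... | no _  | _     = length-filter-split xs

  module _ {q} {Q : A → Set q} (Q? : Decidable Q) where

    length-filter-complement : ∀ xs →
      length xs ≡ length (filter Q? xs) ℕ.+ length (filter (¬? ∘ Q?) xs)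
    length-filter-complement []       = refl
    length-filter-complement (x ∷ xs) with Q? x
    ... | yes _ = cong suc (length-filter-complement xs)
    ... | no _  = trans (cong suc (length-filter-complement xs)) (sym (ℕₚ.+-suc _ _))

𝟙[_] : ∀ {a} {A : Set a} → Dec A → ℕ
𝟙[ yes _ ] = 1
𝟙[ no _ ]  = 0

𝟙-yes : ∀ {a} {A : Set a} (A? : Dec A) → A → 𝟙[ A? ] ≡ 1
𝟙-yes (yes _) _ = refl
𝟙-yes (no ¬a) a = ⊥-elim (¬a a)

𝟙-no : ∀ {a} {A : Set a} (A? : Dec A) → ¬ A → 𝟙[ A? ] ≡ 0
𝟙-no (yes a) ¬a = ⊥-elim (¬a a)
𝟙-no (no _)  _  = refl

𝟙-cong : ∀ {a b} {A : Set a} {B : Set b} (A? : Dec A) (B? : Dec B) →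
         (A → B) → (B → A) → 𝟙[ A? ] ≡ 𝟙[ B? ]
𝟙-cong (yes _) (yes _) _   _   = refl
𝟙-cong (yes a) (no ¬b) a→b _   = ⊥-elim (¬b (a→b a))
𝟙-cong (no ¬a) (yes b) _   b→a = ⊥-elim (¬a (b→a b))
𝟙-cong (no _)  (no _)  _   _   = refl

module FieldAlgebra {q : ℕ} (F : FiniteField q) where

  open FiniteField F public

  commutativeRing : CommutativeRing _ _
  commutativeRing = record { isCommutativeRing = isCommutativeRing }

  open CommutativeRing commutativeRing public
    using (*-comm; *-assoc; *-identityˡ; *-identityʳ; zeroˡ; zeroʳ;
           +-identityˡ; -‿inverseˡ)
  open import Algebra.Properties.Ring (CommutativeRing.ring commutativeRing) public
    using (-‿distribʳ-*; -‿involutive; +-inverseˡ-unique)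
  open import Algebra.Solver.Ring.NaturalCoefficients.Default
    (CommutativeRing.commutativeSemiring commutativeRing)
    using (solve; _:=_; _:+_; _:*_; con)

  infix 8 _⁻¹

  -- The total inverse, with the junk value 0⁻¹ = 0.
  _⁻¹ : Carrier → Carrier
  x ⁻¹ with x ≟ 0#
  ... | yes _   = 0#
  ... | no x≢0 = proj₁ (inverse x x≢0)

  ⁻¹-inverseʳ : ∀ {x} → x ≢ 0# → x * x ⁻¹ ≡ 1#
  ⁻¹-inverseʳ {x} x≢0 with x ≟ 0#
  ... | yes x≡0  = ⊥-elim (x≢0 x≡0)
  ... | no x≢0′ = proj₂ (inverse x x≢0′)

  *-cancelˡ : ∀ {a b c} → a ≢ 0# → a * b ≡ a * c → b ≡ c
  *-cancelˡ {a} {b} {c} a≢0 ab≡ac = begin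
    b                    ≡⟨ *-identityˡ b ⟨
    1# * b               ≡⟨ cong (_* b) (⁻¹-inverseʳ a≢0) ⟨
    a * a ⁻¹ * b         ≡⟨ solve 3 (λ a b a⁻¹ → (a :* a⁻¹) :* b := a⁻¹ :* (a :* b)) refl a b (a ⁻¹) ⟩
    a ⁻¹ * (a * b)       ≡⟨ cong (a ⁻¹ *_) ab≡ac ⟩
    a ⁻¹ * (a * c)       ≡⟨ solve 3 (λ a c a⁻¹ → a⁻¹ :* (a :* c) := (a :* a⁻¹) :* c) refl a c (a ⁻¹) ⟩
    a * a ⁻¹ * c         ≡⟨ cong (_* c) (⁻¹-inverseʳ a≢0) ⟩
    1# * c               ≡⟨ *-identityˡ c ⟩
    c                    ∎
    where open ≡-Reasoning

  *-nonzero : ∀ {a b} → a ≢ 0# → b ≢ 0# → a * b ≢ 0#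
  *-nonzero {a} a≢0 b≢0 ab≡0 = b≢0 (*-cancelˡ a≢0 (trans ab≡0 (sym (zeroʳ a))))

  *-⁻¹-cancelˡ : ∀ {a} b → a ≢ 0# → a * (b * a ⁻¹) ≡ b
  *-⁻¹-cancelˡ {a} b a≢0 = begin
    a * (b * a ⁻¹)  ≡⟨ solve 3 (λ a b a⁻¹ → a :* (b :* a⁻¹) := b :* (a :* a⁻¹)) refl a b (a ⁻¹) ⟩
    b * (a * a ⁻¹)  ≡⟨ cong (b *_) (⁻¹-inverseʳ a≢0) ⟩
    b * 1#          ≡⟨ *-identityʳ b ⟩
    b               ∎
    where open ≡-Reasoning

  -‿≡*-1 : ∀ x → - x ≡ x * - 1#
  -‿≡*-1 x = trans (cong -_ (sym (*-identityʳ x))) (-‿distribʳ-* x 1#)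

  x*x≡1⇒x≡1⊎x≡-1 : ∀ x → x * x ≡ 1# → x ≡ 1# ⊎ x ≡ - 1#
  x*x≡1⇒x≡1⊎x≡-1 x x*x≡1 with (x + 1#) ≟ 0#
  ... | yes x+1≡0 = inj₂ (+-inverseˡ-unique x 1# x+1≡0)
  ... | no x+1≢0  = inj₁ (*-cancelˡ x+1≢0 (begin
    (x + 1#) * x    ≡⟨ solve 1 (λ x → (x :+ con 1) :* x := x :* x :+ x) refl x ⟩
    x * x + x       ≡⟨ cong (_+ x) x*x≡1 ⟩
    1# + x          ≡⟨ solve 1 (λ x → con 1 :+ x := (x :+ con 1) :* con 1) refl x ⟩
    (x + 1#) * 1#   ∎))
    where open ≡-Reasoning

  ^-homo-* : ∀ x m n → x ^ (m ℕ.+ n) ≡ x ^ m * x ^ n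
  ^-homo-* x zero    n = sym (*-identityˡ _)
  ^-homo-* x (suc m) n = trans (cong (x *_) (^-homo-* x m n)) (sym (*-assoc x _ _))

  ^-periodic : ∀ {x N} → x ^ N ≡ 1# → ∀ k → x ^ (k ℕ.* N) ≡ 1#
  ^-periodic         xᴺ≡1 zero    = refl
  ^-periodic {x} {N} xᴺ≡1 (suc k) = begin
    x ^ (N ℕ.+ k ℕ.* N)     ≡⟨ ^-homo-* x N (k ℕ.* N) ⟩
    x ^ N * x ^ (k ℕ.* N)   ≡⟨ cong₂ _*_ xᴺ≡1 (^-periodic xᴺ≡1 k) ⟩
    1# * 1#                 ≡⟨ *-identityˡ 1# ⟩
    1#                      ∎
    where open ≡-Reasoning

  -- y ↦ σ y = -(y + x)/y and u ↦ τ u = -x/(u + 1) are mutually inverse; they carry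
  -- the pairs y, y + x of a difference set to pairs u, u + 1 counted by cyclotomic numbers.
  module DifferenceQuotient (x : Carrier) where

    σ : Carrier → Carrier
    σ y = - (y + x) * y ⁻¹

    τ : Carrier → Carrier
    τ u = - x * (u + 1#) ⁻¹

    y*σy : ∀ {y} → y ≢ 0# → y * σ y ≡ - (y + x)
    y*σy {y} = *-⁻¹-cancelˡ (- (y + x))

    y*[σy+1] : ∀ {y} → y ≢ 0# → y * (σ y + 1#) ≡ - x
    y*[σy+1] {y} y≢0 = +-inverseˡ-unique _ x (begin
      y * (σ y + 1#) + x    ≡⟨ solve 3 (λ y s x → y :* (s :+ con 1) :+ x := y :* s :+ (y :+ x)) refl y (σ y) x ⟩
      y * σ y + (y + x)     ≡⟨ cong (_+ (y + x)) (y*σy y≢0) ⟩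
      - (y + x) + (y + x)   ≡⟨ -‿inverseˡ (y + x) ⟩
      0#                    ∎)
      where open ≡-Reasoning

    [u+1]*τu : ∀ {u} → u + 1# ≢ 0# → (u + 1#) * τ u ≡ - x
    [u+1]*τu = *-⁻¹-cancelˡ (- x)

    [u+1]*[τu+x] : ∀ {u} → u + 1# ≢ 0# → (u + 1#) * (τ u + x) ≡ x * u
    [u+1]*[τu+x] {u} u+1≢0 = begin
      (u + 1#) * (τ u + x)
        ≡⟨ solve 3 (λ u t x → (u :+ con 1) :* (t :+ x) := (u :+ con 1) :* t :+ x :+ x :* u) refl u (τ u) x ⟩
      (u + 1#) * τ u + x + x * u  ≡⟨ cong (λ z → z + x + x * u) ([u+1]*τu u+1≢0) ⟩
      - x + x + x * u             ≡⟨ cong (_+ x * u) (-‿inverseˡ x) ⟩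
      0# + x * u                  ≡⟨ +-identityˡ (x * u) ⟩
      x * u                       ∎
      where open ≡-Reasoning

    τ∘σ : ∀ {y} → y ≢ 0# → σ y + 1# ≢ 0# → τ (σ y) ≡ y
    τ∘σ {y} y≢0 σy+1≢0 = *-cancelˡ σy+1≢0
      (trans ([u+1]*τu σy+1≢0) (sym (trans (*-comm (σ y + 1#) y) (y*[σy+1] y≢0))))

    σ∘τ : ∀ {u} → u + 1# ≢ 0# → τ u ≢ 0# → σ (τ u) ≡ u
    σ∘τ {u} u+1≢0 τu≢0 = *-cancelˡ τu≢0 (trans (y*σy τu≢0) (sym τu*u))
      where
      open ≡-Reasoning
      τu*u : τ u * u ≡ - (τ u + x)
      τu*u = +-inverseˡ-unique _ _ (begin
        τ u * u + (τ u + x)   ≡⟨ solve 3 (λ t u x → t :* u :+ (t :+ x) := (u :+ con 1) :* t :+ x) refl (τ u) u x ⟩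
        (u + 1#) * τ u + x    ≡⟨ cong (_+ x) ([u+1]*τu u+1≢0) ⟩
        - x + x               ≡⟨ -‿inverseˡ x ⟩
        0#                    ∎)

module Counting {q : ℕ} (F : FiniteField q) where

  open FieldAlgebra F

  elements-unique : Unique elements
  elements-unique = Unique.map⁺ (Injection.injective (Inverse⇒Injection enum)) (Unique.allFin⁺ q)

  ∈-elements : ∀ x → x ∈ elements
  ∈-elements x = subst (_∈ elements) (Inverse.strictlyInverseˡ enum x) (∈-map⁺ elem (∈-allFin (index x)))

  length-elements : length elements ≡ q
  length-elements = trans (length-map elem (allFin q)) (length-tabulate (λ i → i))

  module _ {P Q : Carrier → Set} (P? : Decidable P) (Q? : Decidable Q) where

    count-≤ : (σ : Carrier → Carrier) → (∀ {x} → P x → Q (σ x)) →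
              (∀ {x y} → P x → P y → σ x ≡ σ y → x ≡ y) → count P? ≤ count Q?
    count-≤ σ σ-maps σ-injective = subst (_≤ count Q?) (length-map σ (filter P? elements))
      (Unique-⊆⇒length-≤ σ[P]-unique σ[P]⊆Q)
      where
      P-of : ∀ {x} → x ∈ filter P? elements → P x
      P-of x∈ = proj₂ (∈-filter⁻ P? {xs = elements} x∈)
      σ[P]-unique : Unique (map σ (filter P? elements))
      σ[P]-unique = Unique-map⁺ σ (Unique.filter⁺ P? elements-unique) (λ x∈ y∈ → σ-injective (P-of x∈) (P-of y∈))
      σ[P]⊆Q : map σ (filter P? elements) ⊆ filter Q? elements
      σ[P]⊆Q z∈ with ∈-map⁻ σ z∈
      ... | x , x∈ , refl = ∈-filter⁺ Q? (∈-elements (σ x)) (σ-maps (P-of x∈))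

    count-split : count P? ≡ count (λ x → P? x ×-dec Q? x) ℕ.+ count (λ x → P? x ×-dec ¬? (Q? x))
    count-split = length-filter-split P? Q? elements

  module _ {P Q : Carrier → Set} (P? : Decidable P) (Q? : Decidable Q) where

    count-bijection : (σ τ : Carrier → Carrier) → (∀ {x} → P x → Q (σ x)) → (∀ {y} → Q y → P (τ y)) →
                      (∀ {x} → P x → τ (σ x) ≡ x) → (∀ {y} → Q y → σ (τ y) ≡ y) → count P? ≡ count Q?
    count-bijection σ τ σ-maps τ-maps τ∘σ σ∘τ = ℕₚ.≤-antisym
      (count-≤ P? Q? σ σ-maps (λ px py σx≡σy → trans (sym (τ∘σ px)) (trans (cong τ σx≡σy) (τ∘σ py))))
      (count-≤ Q? P? τ τ-maps (λ qx qy τx≡τy → trans (sym (σ∘τ qx)) (trans (cong σ τx≡τy) (σ∘τ qy))))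

    count-cong : (∀ {x} → P x → Q x) → (∀ {x} → Q x → P x) → count P? ≡ count Q?
    count-cong P⇒Q Q⇒P = count-bijection (λ x → x) (λ x → x) P⇒Q Q⇒P (λ _ → refl) (λ _ → refl)

  module _ {P : Carrier → Set} (P? : Decidable P) where

    count-witness : 0 < count P? → ∃ P
    count-witness pos with filter P? elements in eq
    ... | y ∷ _ = y , proj₂ (∈-filter⁻ P? {xs = elements} (subst (y ∈_) (sym eq) (here refl)))

    count-pos : ∀ {x} → P x → 0 < count P?
    count-pos {x} px = filter-some P? (lose (∈-elements x) px)

    count-zero : (∀ x → ¬ P x) → count P? ≡ 0
    count-zero ¬P = cong length (filter-none P? {xs = elements} (All.tabulate (λ {x} _ → ¬P x)))

  count-∈ : ∀ {L} → Unique L → count (_∈? L) ≡ length L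
  count-∈ {L} L-unique = ℕₚ.≤-antisym
    (Unique-⊆⇒length-≤ (Unique.filter⁺ (_∈? L) elements-unique)
                        (λ z∈ → proj₂ (∈-filter⁻ (_∈? L) {xs = elements} z∈)))
    (Unique-⊆⇒length-≤ L-unique (λ {z} z∈ → ∈-filter⁺ (_∈? L) (∈-elements z) z∈))

  count-singleton : ∀ {P : Carrier → Set} (P? : Decidable P) c → (∀ {x} → P x → x ≡ c) → P c → count P? ≡ 1
  count-singleton P? c P⇒≡c Pc =
    trans (count-cong P? (_∈? (c ∷ [])) (λ px → here (P⇒≡c px)) (λ { (here refl) → Pc }))
          (count-∈ (All.[] ∷ []))

  count-𝟙 : ∀ {b} {P : Carrier → Set} {B : Set b} (P? : Decidable P) (B? : Dec B) c →
            (∀ {x} → P x → x ≡ c × B) → (B → P c) → count P? ≡ 𝟙[ B? ]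
  count-𝟙 P? (yes b) c P⇒≡c×B B⇒Pc = count-singleton P? c (proj₁ ∘ P⇒≡c×B) (B⇒Pc b)
  count-𝟙 P? (no ¬b) c P⇒≡c×B _    = count-zero P? (λ x px → ¬b (proj₂ (P⇒≡c×B px)))

  count-nonzero : count (λ x → ¬? (x ≟ 0#)) ≡ q ∸ 1
  count-nonzero = begin
    count nonzero                         ≡⟨ ℕₚ.m+n∸m≡n 1 _ ⟨
    1 ℕ.+ count nonzero ∸ 1               ≡⟨ cong (λ n → n ℕ.+ count nonzero ∸ 1) count-zero≡1 ⟨
    count (_≟ 0#) ℕ.+ count nonzero ∸ 1   ≡⟨ cong (_∸ 1) (length-filter-complement (_≟ 0#) elements) ⟨
    length elements ∸ 1                   ≡⟨ cong (_∸ 1) length-elements ⟩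
    q ∸ 1                                 ∎
    where
    open ≡-Reasoning
    nonzero : Decidable (λ x → ¬ x ≡ 0#)
    nonzero x = ¬? (x ≟ 0#)
    count-zero≡1 : count (_≟ 0#) ≡ 1
    count-zero≡1 = count-singleton (_≟ 0#) 0# (λ x≡0 → x≡0) refl

  ∈-0∷⁻ : ∀ {L y} → y ∈ 0# ∷ L → y ≢ 0# → y ∈ L
  ∈-0∷⁻ (here refl) y≢0 = ⊥-elim (y≢0 refl)
  ∈-0∷⁻ (there y∈L) _   = y∈L

  diffFun-0∷ : ∀ {L} → 0# ∉ L → ∀ {x} → x ≢ 0# →
    diffFun F (0# ∷ L) x ≡ 𝟙[ x ∈? L ] ℕ.+ (𝟙[ (- x) ∈? L ] ℕ.+ count (λ y → (y ∈? L) ×-dec ((y + x) ∈? L)))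
  diffFun-0∷ {L} 0∉L {x} x≢0 = begin
    count both
      ≡⟨ count-split both (_≟ 0#) ⟩
    count (λ y → both y ×-dec (y ≟ 0#)) ℕ.+ count both∖0
      ≡⟨ cong₂ ℕ._+_ y≡0-count (count-split both∖0 (λ y → (y + x) ≟ 0#)) ⟩
    𝟙[ x ∈? L ] ℕ.+ (count (λ y → both∖0 y ×-dec ((y + x) ≟ 0#))
                     ℕ.+ count (λ y → both∖0 y ×-dec ¬? ((y + x) ≟ 0#)))
      ≡⟨ cong (𝟙[ x ∈? L ] ℕ.+_) (cong₂ ℕ._+_ y+x≡0-count rest-count) ⟩
    𝟙[ x ∈? L ] ℕ.+ (𝟙[ (- x) ∈? L ] ℕ.+ count (λ y → (y ∈? L) ×-dec ((y + x) ∈? L)))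
      ∎
    where
    open ≡-Reasoning
    D = 0# ∷ L
    both : Decidable (λ y → y ∈ D × (y + x) ∈ D)
    both y = (y ∈? D) ×-dec ((y + x) ∈? D)
    both∖0 : Decidable (λ y → (y ∈ D × (y + x) ∈ D) × ¬ y ≡ 0#)
    both∖0 y = both y ×-dec ¬? (y ≟ 0#)
    y≡0-count : count (λ y → both y ×-dec (y ≟ 0#)) ≡ 𝟙[ x ∈? L ]
    y≡0-count = count-𝟙 _ (x ∈? L) 0#
      (λ { ((_ , x∈D) , refl) → refl , ∈-0∷⁻ (subst (_∈ D) (+-identityˡ x) x∈D) x≢0 })
      (λ x∈L → (here refl , there (subst (_∈ L) (sym (+-identityˡ x)) x∈L)) , refl)
    y+x≡0-count : count (λ y → both∖0 y ×-dec ((y + x) ≟ 0#)) ≡ 𝟙[ (- x) ∈? L ]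
    y+x≡0-count = count-𝟙 _ ((- x) ∈? L) (- x)
      (λ { (((y∈D , _) , y≢0) , y+x≡0) → let y≡-x = +-inverseˡ-unique _ x y+x≡0 in
             y≡-x , subst (_∈ L) y≡-x (∈-0∷⁻ y∈D y≢0) })
      (λ -x∈L → ((there -x∈L , here (-‿inverseˡ x)) , (λ -x≡0 → 0∉L (subst (_∈ L) -x≡0 -x∈L)))
              , -‿inverseˡ x)
    rest-count : count (λ y → both∖0 y ×-dec ¬? ((y + x) ≟ 0#)) ≡ count (λ y → (y ∈? L) ×-dec ((y + x) ∈? L))
    rest-count = count-cong _ _
      (λ { (((y∈D , y+x∈D) , y≢0) , y+x≢0) → ∈-0∷⁻ y∈D y≢0 , ∈-0∷⁻ y+x∈D y+x≢0 })
      (λ { (y∈L , y+x∈L) → ((there y∈L , there y+x∈L) , (λ { refl → 0∉L y∈L }))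
                         , (λ y+x≡0 → 0∉L (subst (_∈ L) y+x≡0 y+x∈L)) })

  module _ (D : List Carrier) (S : List ℕ)
           (value∈S : ∀ {x} → x ≢ 0# → diffFun F D x ∈ S)
           (attained : ∀ {s} → s ∈ S → ∃ λ x → x ≢ 0# × diffFun F D x ≡ s) where

    IsADS⇔SetEqPair : ∀ {k} lam → size F D ≡ k → (∃ λ t → IsADS F q k lam t D) ⇔ SetEqPair S lam
    IsADS⇔SetEqPair {k} lam |D|≡k = mk⇔ to from
      where
      isLam? : Decidable (λ x → ¬ x ≡ 0# × diffFun F D x ≡ lam)
      isLam? x = ¬? (x ≟ 0#) ×-dec (diffFun F D x ℕ.≟ lam)
      notLam? : Decidable (λ x → ¬ x ≡ 0# × ¬ diffFun F D x ≡ lam)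
      notLam? x = ¬? (x ≟ 0#) ×-dec ¬? (diffFun F D x ℕ.≟ lam)

      q∸1≡lam+notLam : q ∸ 1 ≡ count isLam? ℕ.+ count notLam?
      q∸1≡lam+notLam = trans (sym count-nonzero) (count-split (λ x → ¬? (x ≟ 0#)) (λ x → diffFun F D x ℕ.≟ lam))

      to : (∃ λ t → IsADS F q k lam t D) → SetEqPair S lam
      to (t , _ , _ , twoValued , count≡t , 0<t , t<q-1) = values , lam∈S , 1+lam∈S
        where
        values : ∀ s → s ∈ S → s ≡ lam ⊎ s ≡ suc lam
        values s s∈S with attained s∈S
        ... | x , x≢0 , refl = twoValued x x≢0
        lam∈S : lam ∈ S
        lam∈S with count-witness isLam? (subst (0 <_) (sym count≡t) 0<t)
        ... | x , x≢0 , dx≡lam = subst (_∈ S) dx≡lam (value∈S x≢0)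
        0<notLam : 0 < count notLam?
        0<notLam = ℕₚ.+-cancelˡ-< (count isLam?) 0 (count notLam?) (subst₂ _<_ (sym (ℕₚ.+-identityʳ _)) q∸1≡lam+notLam
                                                    (subst (_< q ∸ 1) (sym count≡t) t<q-1))
        1+lam∈S : suc lam ∈ S
        1+lam∈S with count-witness notLam? 0<notLam
        ... | x , x≢0 , dx≢lam with twoValued x x≢0
        ...   | inj₁ dx≡lam   = ⊥-elim (dx≢lam dx≡lam)
        ...   | inj₂ dx≡1+lam = subst (_∈ S) dx≡1+lam (value∈S x≢0)

      from : SetEqPair S lam → ∃ λ t → IsADS F q k lam t D
      from (values , lam∈S , 1+lam∈S) = count isLam? , refl , |D|≡k , twoValued , refl , 0<t , t<q-1
        where
        twoValued : ∀ x → x ≢ 0# → diffFun F D x ≡ lam ⊎ diffFun F D x ≡ suc lam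
        twoValued x x≢0 = values _ (value∈S x≢0)
        0<t : 0 < count isLam?
        0<t with attained lam∈S
        ... | x , x≢0 , dx≡lam = count-pos isLam? (x≢0 , dx≡lam)
        t<q-1 : count isLam? < q ∸ 1
        t<q-1 with attained 1+lam∈S
        ... | x , x≢0 , dx≡1+lam = subst (count isLam? <_) (sym q∸1≡lam+notLam)
          (ℕₚ.m<m+n (count isLam?) (count-pos notLam? (x≢0 , λ dx≡lam → ℕₚ.1+n≢n (trans (sym dx≡1+lam) dx≡lam))))

suc-<⇒<∸1 : ∀ {j n} → suc j < n → j < n ∸ 1
suc-<⇒<∸1 {n = suc n} (s≤s j<n) = j<n

<∸1⇒suc-< : ∀ {j n} → j < n ∸ 1 → suc j < n
<∸1⇒suc-< {n = suc n} j<n = s≤s j<n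

module Congruence (m : ℕ) .{{_ : NonZero m}} where

  open import Data.Nat using (_+_)
  open ≡-Reasoning

  infix 4 _≡ₘ_

  _≡ₘ_ : ℕ → ℕ → Set
  a ≡ₘ b = a % m ≡ b % m

  %-≡ₘ : ∀ a → a % m ≡ₘ a
  %-≡ₘ a = m%n%n≡m%n a m

  +-congₘ : ∀ {a a′ b b′} → a ≡ₘ a′ → b ≡ₘ b′ → a + b ≡ₘ a′ + b′
  +-congₘ {a} {a′} {b} {b′} a≡a′ b≡b′ = begin
    (a + b) % m              ≡⟨ %-distribˡ-+ a b m ⟩
    (a % m + b % m) % m      ≡⟨ cong₂ (λ u v → (u + v) % m) a≡a′ b≡b′ ⟩
    (a′ % m + b′ % m) % m    ≡⟨ %-distribˡ-+ a′ b′ m ⟨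
    (a′ + b′) % m            ∎

  <⇒≡ₘ⇒≡ : ∀ {a b} → a < m → b < m → a ≡ₘ b → a ≡ b
  <⇒≡ₘ⇒≡ a<m b<m a≡b = trans (sym (m<n⇒m%n≡m a<m)) (trans a≡b (m<n⇒m%n≡m b<m))

  ∸%-inverseₘ : ∀ k → (m ∸ k % m) + k ≡ₘ 0
  ∸%-inverseₘ k = begin
    (m ∸ k % m + k) % m        ≡⟨ +-congₘ {m ∸ k % m} refl (sym (%-≡ₘ k)) ⟩
    (m ∸ k % m + k % m) % m    ≡⟨ cong (_% m) (ℕₚ.m∸n+n≡m (m%n≤n k m)) ⟩
    m % m                      ≡⟨ n%n≡0 m ⟩
    0                          ≡⟨ m*n%n≡0 0 m ⟨
    0 % m                      ∎

  +-cancelˡₘ : ∀ k {a b} → k + a ≡ₘ k + b → a ≡ₘ b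
  +-cancelˡₘ k {a} {b} k+a≡k+b = begin
    a % m                  ≡⟨ +-congₘ {b = a} (∸%-inverseₘ k) refl ⟨
    (c + k + a) % m        ≡⟨ cong (_% m) (ℕₚ.+-assoc c k a) ⟩
    (c + (k + a)) % m      ≡⟨ +-congₘ {c} refl k+a≡k+b ⟩
    (c + (k + b)) % m      ≡⟨ cong (_% m) (ℕₚ.+-assoc c k b) ⟨
    (c + k + b) % m        ≡⟨ +-congₘ {b = b} (∸%-inverseₘ k) refl ⟩
    b % m                  ∎
    where c = m ∸ k % m

  +-solveˡₘ : ∀ k n → ∃ λ r → r < m × k + r ≡ₘ n
  +-solveˡₘ k n = (c + n) % m , m%n<n (c + n) m , (begin
    (k + (c + n) % m) % m   ≡⟨ +-congₘ {k} refl (%-≡ₘ (c + n)) ⟩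
    (k + (c + n)) % m       ≡⟨ cong (_% m) (+-*-Solver.solve 3 (λ k c n → k :+ (c :+ n) := c :+ k :+ n) refl k c n) ⟩
    (c + k + n) % m         ≡⟨ +-congₘ {b = n} (∸%-inverseₘ k) refl ⟩
    n % m                   ∎)
    where
    open +-*-Solver using (_:+_; _:=_)
    c = m ∸ k % m

module Cyclotomy {q : ℕ} (F : FiniteField q) (e f : ℕ) (1≤e : 1 ≤ e) (1≤f : 1 ≤ f)
                 (q≡ef+1 : q ≡ e ℕ.* f ℕ.+ 1)
                 (γ : FiniteField.Carrier F) (γ-primitive : IsPrimitive F γ) where

  open FieldAlgebra F
  open Counting F

  N : ℕ
  N = e ℕ.* f

  instance
    e≢0 : NonZero e
    e≢0 = ℕ.>-nonZero 1≤e

    N≢0 : NonZero N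
    N≢0 = ℕₚ.m*n≢0 e f {{e≢0}} {{ℕ.>-nonZero 1≤f}}

  open Congruence e public

  q∸1≡N : q ∸ 1 ≡ N
  q∸1≡N = trans (cong (_∸ 1) q≡ef+1) (ℕₚ.m+n∸n≡m N 1)

  γ^N≡1 : γ ^ N ≡ 1#
  γ^N≡1 = subst (λ k → γ ^ k ≡ 1#) q∸1≡N (proj₁ γ-primitive)

  γ^k≢1 : ∀ {k} → 0 < k → k < N → γ ^ k ≢ 1#
  γ^k≢1 {k} 0<k k<N = proj₂ γ-primitive k 0<k (subst (k <_) (sym q∸1≡N) k<N)

  γ≢0 : γ ≢ 0#
  γ≢0 γ≡0 = 0≢1 (begin
    0#                      ≡⟨ zeroˡ (γ ^ ℕ.pred N) ⟨
    0# * γ ^ ℕ.pred N       ≡⟨ cong (_* γ ^ ℕ.pred N) γ≡0 ⟨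
    γ ^ suc (ℕ.pred N)      ≡⟨ cong (γ ^_) (ℕₚ.suc-pred N) ⟩
    γ ^ N                   ≡⟨ γ^N≡1 ⟩
    1#                      ∎)
    where open ≡-Reasoning

  γ^-nonzero : ∀ n → γ ^ n ≢ 0#
  γ^-nonzero zero    1≡0 = 0≢1 (sym 1≡0)
  γ^-nonzero (suc n)     = *-nonzero γ≢0 (γ^-nonzero n)

  γ^n≡γ^[n%N] : ∀ n → γ ^ n ≡ γ ^ (n % N)
  γ^n≡γ^[n%N] n = begin
    γ ^ n                                 ≡⟨ cong (γ ^_) (m≡m%n+[m/n]*n n N) ⟩
    γ ^ (n % N ℕ.+ n / N ℕ.* N)           ≡⟨ ^-homo-* γ (n % N) (n / N ℕ.* N) ⟩
    γ ^ (n % N) * γ ^ (n / N ℕ.* N)       ≡⟨ cong (γ ^ (n % N) *_) (^-periodic γ^N≡1 (n / N)) ⟩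
    γ ^ (n % N) * 1#                      ≡⟨ *-identityʳ _ ⟩
    γ ^ (n % N)                           ∎
    where open ≡-Reasoning

  <⇒γ^≢γ^ : ∀ {m n} → m < n → n < N → γ ^ m ≢ γ ^ n
  <⇒γ^≢γ^ {m} {n} m<n n<N γᵐ≡γⁿ = γ^k≢1 (ℕₚ.m<n⇒0<n∸m m<n) (ℕₚ.≤-<-trans (ℕₚ.m∸n≤m n m) n<N)
    (*-cancelˡ (γ^-nonzero m) (begin
      γ ^ m * γ ^ (n ∸ m)   ≡⟨ ^-homo-* γ m (n ∸ m) ⟨
      γ ^ (m ℕ.+ (n ∸ m))   ≡⟨ cong (γ ^_) (ℕₚ.m+[n∸m]≡n (ℕₚ.<⇒≤ m<n)) ⟩
      γ ^ n                 ≡⟨ γᵐ≡γⁿ ⟨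
      γ ^ m                 ≡⟨ *-identityʳ _ ⟨
      γ ^ m * 1#            ∎))
    where open ≡-Reasoning

  γ^-injective : ∀ {m n} → m < N → n < N → γ ^ m ≡ γ ^ n → m ≡ n
  γ^-injective {m} {n} m<N n<N γᵐ≡γⁿ with ℕₚ.<-cmp m n
  ... | tri< m<n _ _ = ⊥-elim (<⇒γ^≢γ^ m<n n<N γᵐ≡γⁿ)
  ... | tri≈ _ m≡n _ = m≡n
  ... | tri> _ _ n<m = ⊥-elim (<⇒γ^≢γ^ n<m m<N (sym γᵐ≡γⁿ))

  γ^≡γ^⇒≡ₘ : ∀ {m n} → γ ^ m ≡ γ ^ n → m ≡ₘ n
  γ^≡γ^⇒≡ₘ {m} {n} γᵐ≡γⁿ = begin
    m % e         ≡⟨ m∣n⇒o%n%m≡o%m e N m (m∣m*n f) ⟨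
    m % N % e     ≡⟨ cong (_% e) (γ^-injective (m%n<n m N) (m%n<n n N) γ^[m%N]≡γ^[n%N]) ⟩
    n % N % e     ≡⟨ m∣n⇒o%n%m≡o%m e N n (m∣m*n f) ⟩
    n % e         ∎
    where
    open ≡-Reasoning
    γ^[m%N]≡γ^[n%N] = trans (sym (γ^n≡γ^[n%N] m)) (trans γᵐ≡γⁿ (γ^n≡γ^[n%N] n))

  powers : List Carrier
  powers = map (γ ^_) (upTo N)

  powers-unique : Unique powers
  powers-unique = Unique-map⁺ (γ ^_) (Unique.upTo⁺ N) (λ m∈ n∈ → γ^-injective (∈-upTo⁻ m∈) (∈-upTo⁻ n∈))

  length-powers : length powers ≡ N
  length-powers = trans (length-map (γ ^_) (upTo N)) (length-upTo N)

  -- Pigeonhole: the N distinct powers already exhaust the N nonzero elements.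
  γ^-surjective : ∀ {w} → w ≢ 0# → ∃ λ n → w ≡ γ ^ n
  γ^-surjective {w} w≢0 with w ∈? powers
  ... | yes w∈powers with ∈-map⁻ (γ ^_) w∈powers
  ...   | n , _ , w≡γⁿ = n , w≡γⁿ
  γ^-surjective {w} w≢0 | no w∉powers = ⊥-elim (ℕₚ.<-irrefl refl (begin-strict
    N                           ≡⟨ length-powers ⟨
    length powers               <⟨ ℕₚ.n<1+n _ ⟩
    length (w ∷ powers)         ≤⟨ Unique-⊆⇒length-≤ (All.¬Any⇒All¬ powers w∉powers ∷ powers-unique) ⊆nonzero ⟩
    count (λ x → ¬? (x ≟ 0#))   ≡⟨ trans count-nonzero q∸1≡N ⟩
    N                           ∎))
    where
    open ℕₚ.≤-Reasoning
    ⊆nonzero : ∀ {z} → z ∈ w ∷ powers → z ∈ filter (λ x → ¬? (x ≟ 0#)) elements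
    ⊆nonzero (here refl)  = ∈-filter⁺ (λ x → ¬? (x ≟ 0#)) (∈-elements w) w≢0
    ⊆nonzero (there z∈) with ∈-map⁻ (γ ^_) z∈
    ... | n , _ , refl = ∈-filter⁺ (λ x → ¬? (x ≟ 0#)) (∈-elements _) (γ^-nonzero n)

  γ^half≡-1 : ∀ {h} → h ℕ.+ h ≡ N → γ ^ h ≡ - 1#
  γ^half≡-1 {zero}  0≡N = ⊥-elim (ℕ.NonZero.nonZero (subst NonZero (sym 0≡N) N≢0))
  γ^half≡-1 {suc h} h+h≡N = [ ⊥-elim ∘ γʰ≢1 , id ]′ (x*x≡1⇒x≡1⊎x≡-1 (γ ^ suc h) γʰ*γʰ≡1)
    where
    γʰ*γʰ≡1 : γ ^ suc h * γ ^ suc h ≡ 1#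
    γʰ*γʰ≡1 = trans (sym (^-homo-* γ (suc h) (suc h))) (trans (cong (γ ^_) h+h≡N) γ^N≡1)
    γʰ≢1 : γ ^ suc h ≢ 1#
    γʰ≢1 = γ^k≢1 (s≤s z≤n) (subst (suc h <_) h+h≡N (ℕₚ.m<m+n (suc h) (s≤s z≤n)))

  infix 4 _∈C_

  -- Membership in C_k stated through exponents, so that k is read modulo e.
  _∈C_ : Carrier → ℕ → Set
  w ∈C k = ∃ λ n → w ≡ γ ^ n × n ≡ₘ k

  γ^∈C : ∀ n → γ ^ n ∈C n
  γ^∈C n = n , refl , refl

  ∈C⇒≢0 : ∀ {w k} → w ∈C k → w ≢ 0#
  ∈C⇒≢0 (n , refl , _) = γ^-nonzero n

  ∈C-resp-≡ₘ : ∀ {w k l} → k ≡ₘ l → w ∈C k → w ∈C l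
  ∈C-resp-≡ₘ k≡l (n , w≡γⁿ , n≡k) = n , w≡γⁿ , trans n≡k k≡l

  ∈C-unique : ∀ {w k l} → w ∈C k → w ∈C l → k ≡ₘ l
  ∈C-unique (n , refl , n≡k) (m , γⁿ≡γᵐ , m≡l) = trans (sym n≡k) (trans (γ^≡γ^⇒≡ₘ γⁿ≡γᵐ) m≡l)

  ∈C-* : ∀ {a b k l} → a ∈C k → b ∈C l → a * b ∈C k ℕ.+ l
  ∈C-* (n , refl , n≡k) (m , refl , m≡l) = n ℕ.+ m , sym (^-homo-* γ n m) , +-congₘ n≡k m≡l

  ∈C-cancelˡ : ∀ {a b k t} → a ∈C k → a * b ∈C k ℕ.+ t → b ∈C t
  ∈C-cancelˡ {a} {b} {k} a∈Cₖ ab∈C with b ≟ 0#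
  ... | yes refl = ⊥-elim (∈C⇒≢0 ab∈C (zeroʳ a))
  ... | no b≢0 with γ^-surjective b≢0
  ...   | n , refl = ∈C-resp-≡ₘ (+-cancelˡₘ k (∈C-unique (∈C-* a∈Cₖ (γ^∈C n)) ab∈C)) (γ^∈C n)

  C : ℕ → List Carrier
  C = cyclotomicClass F γ e f

  ∈-C⇒∈C : ∀ {w k} → w ∈ C k → w ∈C k
  ∈-C⇒∈C {k = k} w∈ with ∈-map⁻ (λ s → γ ^ (e ℕ.* s ℕ.+ k)) w∈
  ... | s , _ , w≡γ^[es+k] = e ℕ.* s ℕ.+ k , w≡γ^[es+k] , (begin
    (e ℕ.* s ℕ.+ k) % e   ≡⟨ cong (_% e) (ℕₚ.+-comm (e ℕ.* s) k) ⟩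
    (k ℕ.+ e ℕ.* s) % e   ≡⟨ %-remove-+ʳ k (m∣m*n s) ⟩
    k % e                 ∎)
    where open ≡-Reasoning

  ∈C⇒∈-C : ∀ {w k} → k < e → w ∈C k → w ∈ C k
  ∈C⇒∈-C {k = k} k<e (n , refl , n≡k) =
    subst (_∈ C k) (trans (cong (γ ^_) es+k≡n%N) (sym (γ^n≡γ^[n%N] n)))
          (∈-map⁺ (λ s → γ ^ (e ℕ.* s ℕ.+ k)) (∈-upTo⁺ s<f))
    where
    open ≡-Reasoning
    ρ = n % N
    ρ%e≡k : ρ % e ≡ k
    ρ%e≡k = trans (m∣n⇒o%n%m≡o%m e N n (m∣m*n f)) (trans n≡k (m<n⇒m%n≡m k<e))
    s = ρ / e
    s<f : s < f
    s<f = m<n*o⇒m/o<n (subst (ρ <_) (ℕₚ.*-comm e f) (m%n<n n N))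
    es+k≡n%N : e ℕ.* s ℕ.+ k ≡ ρ
    es+k≡n%N = begin
      e ℕ.* s ℕ.+ k       ≡⟨ cong₂ ℕ._+_ (ℕₚ.*-comm e s) (sym ρ%e≡k) ⟩
      s ℕ.* e ℕ.+ ρ % e   ≡⟨ ℕₚ.+-comm (s ℕ.* e) (ρ % e) ⟩
      ρ % e ℕ.+ s ℕ.* e   ≡⟨ m≡m%n+[m/n]*n ρ e ⟨
      ρ                   ∎

  0∉C : ∀ {k} → 0# ∉ C k
  0∉C 0∈C = ∈C⇒≢0 (∈-C⇒∈C 0∈C) refl

  C-unique : ∀ {k} → k < e → Unique (C k)
  C-unique {k} k<e = Unique-map⁺ (λ s → γ ^ (e ℕ.* s ℕ.+ k)) (Unique.upTo⁺ f)
    (λ {s} {s′} s∈ s′∈ eq → ℕₚ.*-cancelˡ-≡ s s′ e (ℕₚ.+-cancelʳ-≡ k (e ℕ.* s) (e ℕ.* s′)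
       (γ^-injective (es+k<N (∈-upTo⁻ s∈)) (es+k<N (∈-upTo⁻ s′∈)) eq)))
    where
    es+k<N : ∀ {s} → s < f → e ℕ.* s ℕ.+ k < N
    es+k<N {s} s<f = begin-strict
      e ℕ.* s ℕ.+ k   <⟨ ℕₚ.+-monoʳ-< (e ℕ.* s) k<e ⟩
      e ℕ.* s ℕ.+ e   ≡⟨ ℕₚ.+-comm (e ℕ.* s) e ⟩
      e ℕ.+ e ℕ.* s   ≡⟨ ℕₚ.*-suc e s ⟨
      e ℕ.* suc s     ≤⟨ ℕₚ.*-monoʳ-≤ e s<f ⟩
      N               ∎
      where open ℕₚ.≤-Reasoning

  length-C : ∀ k → length (C k) ≡ f
  length-C k = trans (length-map (λ s → γ ^ (e ℕ.* s ℕ.+ k)) (upTo f)) (length-upTo f)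

  module _ {h : ℕ} (h<e : h < e) (-1∈Cₕ : - 1# ∈C h) where

    ∈C-neg : ∀ {w k} → w ∈C k → - w ∈C k ℕ.+ h
    ∈C-neg {w} w∈Cₖ = subst (_∈C _) (sym (-‿≡*-1 w)) (∈C-* w∈Cₖ -1∈Cₕ)

    -- 2h ≡ 0 (mod e) because (-1)² = 1 ∈ C₀.
    +h+h≡ₘ : ∀ k → k ℕ.+ h ℕ.+ h ≡ₘ k
    +h+h≡ₘ k = begin
      (k ℕ.+ h ℕ.+ h) % e     ≡⟨ cong (_% e) (ℕₚ.+-assoc k h h) ⟩
      (k ℕ.+ (h ℕ.+ h)) % e   ≡⟨ +-congₘ {k} refl h+h≡0 ⟩
      (k ℕ.+ 0) % e           ≡⟨ cong (_% e) (ℕₚ.+-identityʳ k) ⟩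
      k % e                   ∎
      where
      open ≡-Reasoning
      h+h≡0 : h ℕ.+ h ≡ₘ 0
      h+h≡0 = ∈C-unique (subst (_∈C _) (-‿involutive 1#) (∈C-neg -1∈Cₕ)) (γ^∈C 0)

    -‿nonzero : ∀ {x} → x ≢ 0# → - x ≢ 0#
    -‿nonzero {x} x≢0 = subst (_≢ 0#) (sym (-‿≡*-1 x)) (*-nonzero x≢0 (∈C⇒≢0 -1∈Cₕ))

    module DifferenceSet {i : ℕ} (i<e : i < e) where

      D : List Carrier
      D = 0# ∷ C i

      size-D : size F D ≡ suc f
      size-D = trans (count-∈ (All.tabulate (λ z∈ 0≡z → 0∉C (subst (_∈ C i) (sym 0≡z) z∈)) ∷ C-unique i<e))
                     (cong suc (length-C i))

      dValue : ℕ → ℕ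
      dValue r = 𝟙[ r ℕ.≟ h ] ℕ.+ (𝟙[ r ℕ.≟ 0 ] ℕ.+ cyclotomicNumber F γ e f h r)

      module _ {x : Carrier} {r : ℕ} (x≢0 : x ≢ 0#) (r<e : r < e) (-x∈Cᵢ₊ᵣ : - x ∈C i ℕ.+ r) where

        open DifferenceQuotient x

        x∈Cᵢ₊ᵣ₊ₕ : x ∈C i ℕ.+ r ℕ.+ h
        x∈Cᵢ₊ᵣ₊ₕ = subst (_∈C _) (-‿involutive x) (∈C-neg -x∈Cᵢ₊ᵣ)

        x∈C⇔r≡h : 𝟙[ x ∈? C i ] ≡ 𝟙[ r ℕ.≟ h ]
        x∈C⇔r≡h = 𝟙-cong (x ∈? C i) (r ℕ.≟ h)
          (λ x∈Cᵢ → <⇒≡ₘ⇒≡ r<e h<e (+-cancelˡₘ i (∈C-unique -x∈Cᵢ₊ᵣ (∈C-neg (∈-C⇒∈C x∈Cᵢ)))))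
          (λ { refl → ∈C⇒∈-C i<e (∈C-resp-≡ₘ (+h+h≡ₘ i) x∈Cᵢ₊ᵣ₊ₕ) })

        -x∈C⇔r≡0 : 𝟙[ (- x) ∈? C i ] ≡ 𝟙[ r ℕ.≟ 0 ]
        -x∈C⇔r≡0 = 𝟙-cong ((- x) ∈? C i) (r ℕ.≟ 0)
          (λ -x∈Cᵢ → <⇒≡ₘ⇒≡ r<e 1≤e (+-cancelˡₘ i (∈C-unique -x∈Cᵢ₊ᵣ
                       (∈C-resp-≡ₘ (cong (_% e) (sym (ℕₚ.+-identityʳ i))) (∈-C⇒∈C -x∈Cᵢ)))))
          (λ { refl → ∈C⇒∈-C i<e (∈C-resp-≡ₘ (cong (_% e) (ℕₚ.+-identityʳ i)) -x∈Cᵢ₊ᵣ) })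

        pairs≡cyclotomicNumber : count (λ y → (y ∈? C i) ×-dec ((y + x) ∈? C i)) ≡ cyclotomicNumber F γ e f h r
        pairs≡cyclotomicNumber = count-bijection _ _ σ τ σ-maps τ-maps
          (λ (y∈ , _) → τ∘σ (∈C⇒≢0 (∈-C⇒∈C y∈)) (∈C⇒≢0 (σy+1∈Cᵣ (∈-C⇒∈C y∈))))
          (λ (_ , u+1∈) → σ∘τ (∈C⇒≢0 (∈-C⇒∈C u+1∈)) (∈C⇒≢0 (τu∈Cᵢ (∈-C⇒∈C u+1∈))))
          where
          σy+1∈Cᵣ : ∀ {y} → y ∈C i → σ y + 1# ∈C r
          σy+1∈Cᵣ y∈Cᵢ = ∈C-cancelˡ y∈Cᵢ (subst (_∈C _) (sym (y*[σy+1] (∈C⇒≢0 y∈Cᵢ))) -x∈Cᵢ₊ᵣ)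

          σ-maps : ∀ {y} → y ∈ C i × y + x ∈ C i → σ y ∈ C h × σ y + 1# ∈ C r
          σ-maps (y∈ , y+x∈) =
            ∈C⇒∈-C h<e (∈C-cancelˡ y∈Cᵢ (subst (_∈C _) (sym (y*σy (∈C⇒≢0 y∈Cᵢ))) (∈C-neg (∈-C⇒∈C y+x∈))))
            , ∈C⇒∈-C r<e (σy+1∈Cᵣ y∈Cᵢ)
            where y∈Cᵢ = ∈-C⇒∈C y∈

          τu∈Cᵢ : ∀ {u} → u + 1# ∈C r → τ u ∈C i
          τu∈Cᵢ u+1∈Cᵣ = ∈C-cancelˡ u+1∈Cᵣ (subst (_∈C _) (sym ([u+1]*τu (∈C⇒≢0 u+1∈Cᵣ)))
                                              (∈C-resp-≡ₘ (cong (_% e) (ℕₚ.+-comm i r)) -x∈Cᵢ₊ᵣ))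

          τ-maps : ∀ {u} → u ∈ C h × u + 1# ∈ C r → τ u ∈ C i × τ u + x ∈ C i
          τ-maps (u∈ , u+1∈) =
            ∈C⇒∈-C i<e (τu∈Cᵢ u+1∈Cᵣ)
            , ∈C⇒∈-C i<e (∈C-cancelˡ u+1∈Cᵣ (subst (_∈C _) (sym ([u+1]*[τu+x] (∈C⇒≢0 u+1∈Cᵣ)))
                (∈C-resp-≡ₘ i+r+h+h≡r+i (∈C-* x∈Cᵢ₊ᵣ₊ₕ (∈-C⇒∈C u∈)))))
            where
            u+1∈Cᵣ = ∈-C⇒∈C u+1∈
            i+r+h+h≡r+i : i ℕ.+ r ℕ.+ h ℕ.+ h ≡ₘ r ℕ.+ i
            i+r+h+h≡r+i = trans (+h+h≡ₘ (i ℕ.+ r)) (cong (_% e) (ℕₚ.+-comm i r))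

        diffFun≡dValue : diffFun F D x ≡ dValue r
        diffFun≡dValue = begin
          diffFun F D x
            ≡⟨ diffFun-0∷ 0∉C x≢0 ⟩
          𝟙[ x ∈? C i ] ℕ.+ (𝟙[ (- x) ∈? C i ] ℕ.+ count (λ y → (y ∈? C i) ×-dec ((y + x) ∈? C i)))
            ≡⟨ cong₂ ℕ._+_ x∈C⇔r≡h (cong₂ ℕ._+_ -x∈C⇔r≡0 pairs≡cyclotomicNumber) ⟩
          dValue r ∎
          where open ≡-Reasoning

      diffFun-value : ∀ {x} → x ≢ 0# → ∃ λ r → r < e × diffFun F D x ≡ dValue r
      diffFun-value {x} x≢0 with γ^-surjective (-‿nonzero x≢0)
      ... | n , -x≡γⁿ with +-solveˡₘ i n
      ...   | r , r<e , i+r≡n = r , r<e , diffFun≡dValue x≢0 r<e (n , -x≡γⁿ , sym i+r≡n)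

      dValue-attained : ∀ {r} → r < e → ∃ λ x → x ≢ 0# × diffFun F D x ≡ dValue r
      dValue-attained {r} r<e = - (γ ^ (i ℕ.+ r)) , -γ^≢0
                              , diffFun≡dValue -γ^≢0 r<e (subst (_∈C _) (sym (-‿involutive _)) (γ^∈C (i ℕ.+ r)))
        where -γ^≢0 = -‿nonzero (γ^-nonzero (i ℕ.+ r))

      IsADS⇔SetEqPair-dValue : ∀ (S : List ℕ) lam →
        (∀ {r} → r < e → dValue r ∈ S) → (∀ {s} → s ∈ S → ∃ λ r → r < e × dValue r ≡ s) →
        (∃ λ t → IsADS F q (suc f) lam t D) ⇔ SetEqPair S lam
      IsADS⇔SetEqPair-dValue S lam dValue∈S S⊆dValues = IsADS⇔SetEqPair D S value∈S attained lam size-D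
        where
        value∈S : ∀ {x} → x ≢ 0# → diffFun F D x ∈ S
        value∈S x≢0 = let r , r<e , dx≡dr = diffFun-value x≢0 in subst (_∈ S) (sym dx≡dr) (dValue∈S r<e)
        attained : ∀ {s} → s ∈ S → ∃ λ x → x ≢ 0# × diffFun F D x ≡ s
        attained s∈S = let r , r<e , dr≡s = S⊆dValues s∈S
                           x , x≢0 , dx≡dr = dValue-attained r<e
                       in x , x≢0 , trans dx≡dr dr≡s

  -1∈C₀ : f % 2 ≡ 0 → - 1# ∈C 0
  -1∈C₀ f%2≡0 = e ℕ.* g , sym (γ^half≡-1 {e ℕ.* g} h+h≡N) , h≡ₘ0
    where
    open +-*-Solver using (_:+_; _:*_; _:=_; con)
    g = f / 2
    h+h≡N : e ℕ.* g ℕ.+ e ℕ.* g ≡ N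
    h+h≡N = begin
      e ℕ.* g ℕ.+ e ℕ.* g     ≡⟨ +-*-Solver.solve 2 (λ e g → e :* g :+ e :* g := e :* (g :* con 2)) refl e g ⟩
      e ℕ.* (g ℕ.* 2)         ≡⟨ cong (λ z → e ℕ.* (z ℕ.+ g ℕ.* 2)) f%2≡0 ⟨
      e ℕ.* (f % 2 ℕ.+ g ℕ.* 2) ≡⟨ cong (e ℕ.*_) (m≡m%n+[m/n]*n f 2) ⟨
      N                       ∎
      where open ≡-Reasoning
    h≡ₘ0 : e ℕ.* g ≡ₘ 0
    h≡ₘ0 = trans (cong (_% e) (ℕₚ.*-comm e g)) (trans (m*n%n≡0 g e) (sym (m*n%n≡0 0 e)))

  e%2≡0 : q % 2 ≡ 1 → f % 2 ≡ 1 → e % 2 ≡ 0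
  e%2≡0 q%2≡1 f%2≡1 with e % 2 in e%2≡ | m%n<n e 2
  ... | 0 | _ = refl
  ... | 1 | _ = ⊥-elim (ℕₚ.0≢1+n (begin
    0                                             ≡⟨⟩
    ((1 ℕ.* 1) % 2 ℕ.+ 1) % 2                     ≡⟨ cong₂ (λ a b → ((a ℕ.* b) % 2 ℕ.+ 1) % 2) e%2≡ f%2≡1 ⟨
    ((e % 2 ℕ.* (f % 2)) % 2 ℕ.+ 1) % 2           ≡⟨ cong (λ z → (z ℕ.+ 1) % 2) (%-distribˡ-* e f 2) ⟨
    (N % 2 ℕ.+ 1 % 2) % 2                         ≡⟨ %-distribˡ-+ N 1 2 ⟨
    (N ℕ.+ 1) % 2                                 ≡⟨ cong (_% 2) q≡ef+1 ⟨
    q % 2                                         ≡⟨ q%2≡1 ⟩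
    1                                             ∎))
    where open ≡-Reasoning
  ... | suc (suc _) | s≤s (s≤s ())

  -- With e = 2c and f = 2g + 1, the half-order N/2 = c f is c modulo e.
  -1∈C[e/2] : q % 2 ≡ 1 → f % 2 ≡ 1 → - 1# ∈C e / 2
  -1∈C[e/2] q%2≡1 f%2≡1 = c ℕ.* f , sym (γ^half≡-1 {c ℕ.* f} h+h≡N) , h≡ₘc
    where
    open ≡-Reasoning
    open +-*-Solver using (_:+_; _:*_; _:=_; con)
    c = e / 2
    g = f / 2
    e≡c*2 : e ≡ c ℕ.* 2
    e≡c*2 = trans (m≡m%n+[m/n]*n e 2) (cong (ℕ._+ c ℕ.* 2) (e%2≡0 q%2≡1 f%2≡1))
    f≡1+g*2 : f ≡ 1 ℕ.+ g ℕ.* 2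
    f≡1+g*2 = trans (m≡m%n+[m/n]*n f 2) (cong (ℕ._+ g ℕ.* 2) f%2≡1)
    h+h≡N : c ℕ.* f ℕ.+ c ℕ.* f ≡ N
    h+h≡N = begin
      c ℕ.* f ℕ.+ c ℕ.* f     ≡⟨ +-*-Solver.solve 2 (λ c f → c :* f :+ c :* f := c :* con 2 :* f) refl c f ⟩
      c ℕ.* 2 ℕ.* f           ≡⟨ cong (ℕ._* f) e≡c*2 ⟨
      N                       ∎
    h≡ₘc : c ℕ.* f ≡ₘ c
    h≡ₘc = begin
      (c ℕ.* f) % e                   ≡⟨ cong (λ z → (c ℕ.* z) % e) f≡1+g*2 ⟩
      (c ℕ.* (1 ℕ.+ g ℕ.* 2)) % e
        ≡⟨ cong (_% e) (+-*-Solver.solve 2 (λ c g → c :* (con 1 :+ g :* con 2) := c :+ g :* (c :* con 2)) refl c g) ⟩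
      (c ℕ.+ g ℕ.* (c ℕ.* 2)) % e     ≡⟨ cong (λ z → (c ℕ.+ g ℕ.* z) % e) e≡c*2 ⟨
      (c ℕ.+ g ℕ.* e) % e             ≡⟨ [m+kn]%n≡m%n c g e ⟩
      c % e                           ∎

  e/2≢0 : q % 2 ≡ 1 → f % 2 ≡ 1 → e / 2 ≢ 0
  e/2≢0 q%2≡1 f%2≡1 e/2≡0 = ℕ.NonZero.nonZero (subst NonZero e≡0 e≢0)
    where
    e≡0 : e ≡ 0
    e≡0 = trans (m≡m%n+[m/n]*n e 2) (cong₂ (λ a b → a ℕ.+ b ℕ.* 2) (e%2≡0 q%2≡1 f%2≡1) e/2≡0)

  cyc : ℕ → ℕ → ℕ
  cyc = cyclotomicNumber F γ e f

  module EvenCase (f%2≡0 : f % 2 ≡ 0) {i : ℕ} (i<e : i < e) where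

    open DifferenceSet 1≤e (-1∈C₀ f%2≡0) i<e

    S₀ : List ℕ
    S₀ = cyc 0 0 ℕ.+ 2 ∷ map (λ j → cyc 0 (suc j)) (upTo (e ∸ 1))

    dValue∈S₀ : ∀ {r} → r < e → dValue r ∈ S₀
    dValue∈S₀ {zero}  _     = here (ℕₚ.+-comm 2 (cyc 0 0))
    dValue∈S₀ {suc j} 1+j<e = there (∈-map⁺ (λ j → cyc 0 (suc j)) (∈-upTo⁺ (suc-<⇒<∸1 1+j<e)))

    S₀⊆dValues : ∀ {s} → s ∈ S₀ → ∃ λ r → r < e × dValue r ≡ s
    S₀⊆dValues (here refl) = 0 , 1≤e , ℕₚ.+-comm 2 (cyc 0 0)
    S₀⊆dValues (there s∈) with ∈-map⁻ (λ j → cyc 0 (suc j)) s∈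
    ... | j , j∈ , refl = suc j , <∸1⇒suc-< (∈-upTo⁻ j∈) , refl

    IsADS⇔SetEqPair-S₀ : ∀ lam → (∃ λ t → IsADS F q (suc f) lam t (0# ∷ C i)) ⇔ SetEqPair S₀ lam
    IsADS⇔SetEqPair-S₀ lam = IsADS⇔SetEqPair-dValue S₀ lam dValue∈S₀ S₀⊆dValues

  module OddCase (q%2≡1 : q % 2 ≡ 1) (f%2≡1 : f % 2 ≡ 1) {i : ℕ} (i<e : i < e) where

    c : ℕ
    c = e / 2

    open DifferenceSet (m/n<m e 2 (s≤s (s≤s z≤n))) (-1∈C[e/2] q%2≡1 f%2≡1) i<e

    c≢0 : c ≢ 0
    c≢0 = e/2≢0 q%2≡1 f%2≡1

    other? : Decidable (λ j → ¬ j ≡ 0 × ¬ j ≡ c)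
    other? j = ¬? (j ℕ.≟ 0) ×-dec ¬? (j ℕ.≟ c)

    otherIndices : List ℕ
    otherIndices = filter other? (upTo e)

    S₁ : List ℕ
    S₁ = cyc c 0 ℕ.+ 1 ∷ cyc c c ℕ.+ 1 ∷ map (λ j → cyc c j) otherIndices

    dValue-0 : dValue 0 ≡ cyc c 0 ℕ.+ 1
    dValue-0 = trans (cong (ℕ._+ suc (cyc c 0)) (𝟙-no (0 ℕ.≟ c) (c≢0 ∘ sym))) (ℕₚ.+-comm 1 (cyc c 0))

    dValue-c : dValue c ≡ cyc c c ℕ.+ 1
    dValue-c = begin
      𝟙[ c ℕ.≟ c ] ℕ.+ (𝟙[ c ℕ.≟ 0 ] ℕ.+ cyc c c)
        ≡⟨ cong₂ (λ a b → a ℕ.+ (b ℕ.+ cyc c c)) (𝟙-yes (c ℕ.≟ c) refl) (𝟙-no (c ℕ.≟ 0) c≢0) ⟩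
      1 ℕ.+ cyc c c                               ≡⟨ ℕₚ.+-comm 1 (cyc c c) ⟩
      cyc c c ℕ.+ 1                               ∎
      where open ≡-Reasoning

    dValue-other : ∀ {r} → r ≢ 0 → r ≢ c → dValue r ≡ cyc c r
    dValue-other {r} r≢0 r≢c =
      cong₂ (λ a b → a ℕ.+ (b ℕ.+ cyc c r)) (𝟙-no (r ℕ.≟ c) r≢c) (𝟙-no (r ℕ.≟ 0) r≢0)

    dValue∈S₁ : ∀ {r} → r < e → dValue r ∈ S₁
    dValue∈S₁ {r} r<e = classify (r ℕ.≟ 0) (r ℕ.≟ c)
      where
      classify : Dec (r ≡ 0) → Dec (r ≡ c) → dValue r ∈ S₁
      classify (yes refl) _          = here dValue-0
      classify (no _)     (yes refl) = there (here dValue-c)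
      classify (no r≢0)   (no r≢c)   = there (there (subst (_∈ map (λ j → cyc c j) otherIndices)
        (sym (dValue-other r≢0 r≢c)) (∈-map⁺ (λ j → cyc c j) (∈-filter⁺ other? (∈-upTo⁺ r<e) (r≢0 , r≢c)))))

    S₁⊆dValues : ∀ {s} → s ∈ S₁ → ∃ λ r → r < e × dValue r ≡ s
    S₁⊆dValues (here refl)         = 0 , 1≤e , dValue-0
    S₁⊆dValues (there (here refl)) = c , m/n<m e 2 (s≤s (s≤s z≤n)) , dValue-c
    S₁⊆dValues (there (there s∈)) with ∈-map⁻ (λ j → cyc c j) s∈
    ... | j , j∈ , refl with ∈-filter⁻ other? {xs = upTo e} j∈
    ...   | j∈upTo , j≢0 , j≢c = j , ∈-upTo⁻ j∈upTo , dValue-other j≢0 j≢c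

    IsADS⇔SetEqPair-S₁ : ∀ lam → (∃ λ t → IsADS F q (suc f) lam t (0# ∷ C i)) ⇔ SetEqPair S₁ lam
    IsADS⇔SetEqPair-S₁ lam = IsADS⇔SetEqPair-dValue S₁ lam dValue∈S₁ S₁⊆dValues

⇔-inj₁ : ∀ {A B B′ P Q : Set} → P → ¬ Q → A ⇔ B → A ⇔ (P × B ⊎ Q × B′)
⇔-inj₁ p ¬q A⇔B = mk⇔ (λ a → inj₁ (p , Equivalence.to A⇔B a))
  λ { (inj₁ (_ , b)) → Equivalence.from A⇔B b ; (inj₂ (q , _)) → ⊥-elim (¬q q) }

⇔-inj₂ : ∀ {A B B′ P Q : Set} → ¬ P → Q → A ⇔ B′ → A ⇔ (P × B ⊎ Q × B′)
⇔-inj₂ ¬p q A⇔B′ = mk⇔ (λ a → inj₂ (q , Equivalence.to A⇔B′ a))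
  λ { (inj₁ (p , _)) → ⊥-elim (¬p p) ; (inj₂ (_ , b′)) → Equivalence.from A⇔B′ b′ }

%2-parity : ∀ n → n % 2 ≡ 0 ⊎ n % 2 ≡ 1
%2-parity n with n % 2 | m%n<n n 2
... | 0           | _               = inj₁ refl
... | 1           | _               = inj₂ refl
... | suc (suc _) | s≤s (s≤s ())

open import Data.Nat using (_+_; _*_; _≟_)

mainTheorem5 : (q e f : ℕ) → 1 ≤ e → 1 ≤ f → q ≡ e * f + 1 → IsPrimePower q → q % 2 ≡ 1 →
  (F : FiniteField q) (γ : FiniteField.Carrier F) → IsPrimitive F γ →
  (i : ℕ) → i < e → (lam : ℕ) →
  (∃ (λ t → IsADS F q (suc f) lam t (FiniteField.0# F ∷ cyclotomicClass F γ e f i)))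
  ⇔
  ((f % 2 ≡ 0 ×
      SetEqPair (cyclotomicNumber F γ e f 0 0 + 2
                 ∷ map (λ j → cyclotomicNumber F γ e f 0 (suc j)) (upTo (e ∸ 1))) lam)
   ⊎
   (f % 2 ≡ 1 ×
      SetEqPair (cyclotomicNumber F γ e f (e / 2) 0 + 1
                 ∷ cyclotomicNumber F γ e f (e / 2) (e / 2) + 1
                 ∷ map (λ j → cyclotomicNumber F γ e f (e / 2) j)
                       (filter (λ j → ¬? (j ≟ 0) ×-dec ¬? (j ≟ e / 2)) (upTo e))) lam))
mainTheorem5 q e f 1≤e 1≤f q≡ef+1 _ q%2≡1 F γ γ-primitive i i<e lam =
  [ (λ f%2≡0 → ⇔-inj₁ f%2≡0 (even⇒¬odd f%2≡0)
                 (EvenCase.IsADS⇔SetEqPair-S₀ f%2≡0 i<e lam))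
  , (λ f%2≡1 → ⇔-inj₂ (λ f%2≡0 → even⇒¬odd f%2≡0 f%2≡1) f%2≡1
                 (OddCase.IsADS⇔SetEqPair-S₁ q%2≡1 f%2≡1 i<e lam))
  ]′ (%2-parity f)
  where
  open Cyclotomy F e f 1≤e 1≤f q≡ef+1 γ γ-primitive
  even⇒¬odd : f % 2 ≡ 0 → f % 2 ≢ 1
  even⇒¬odd f%2≡0 f%2≡1 = ℕₚ.0≢1+n (trans (sym f%2≡0) f%2≡1)
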